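{- Let $G$ be a graph and let $D$ be a pebble distribution on $G$ such that $D(v)=3$ for some vertex $v$ and $D(u)\leq 1$ for every vertex $u\neq v$. Then $D$ is not optimal.
   Context: All graphs are finite and simple. A pebble distribution on a graph $G$ is a function $D:V(G)\to\mathbb{Z}_{\geq 0}$; its size is $|D|=\sum_v D(v)$. A pebbling move removes two pebbles from a vertex having at least two pebbles and places one pebble on an adjacent vertex. A vertex $w$ is reachable under $D$ if some sequence of pebbling moves, each applied to a vertex having at least two pebbles at that time, results in at least one pebble on $w$. $D$ is solvable if every vertex is reachable. $D$ is optimal if it is solvable and has minimum size among solvable distributions on $G$. -}

module Defs where

open import Data.Nat using (ℕ; zero; suc; _+_; _≤_; _∸_)
open import Data.Fin using (Fin; _≟_)
open import Data.Product using (Σ; _×_; ∃)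
open import Data.Empty using (⊥)
open import Relation.Nullary using (¬_; yes; no)
open import Relation.Binary.PropositionalEquality using (_≡_)
open import Relation.Binary.Construct.Closure.ReflexiveTransitive using (Star)
open import Level using (0ℓ)

record Graph : Set₁ where
  field
    n     : ℕ
    Adj   : Fin n → Fin n → Set
    irrefl : ∀ {u} → ¬ Adj u u
    sym   : ∀ {u v} → Adj u v → Adj v u

open Graph public

Distribution : Graph → Set
Distribution G = Fin (n G) → ℕ

sumFin : (k : ℕ) → (Fin k → ℕ) → ℕ
sumFin zero    f = 0
sumFin (suc k) f = f Fin.zero + sumFin k (λ i → f (Fin.suc i))

size : (G : Graph) → Distribution G → ℕ
size G D = sumFin (n G) D

-- Result of a pebbling move from u to v (u ≠ v since Adj is irreflexive):
-- D(u) decreases by 2, D(v) increases by 1, all else unchanged.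
applyMove : (G : Graph) → Distribution G → Fin (n G) → Fin (n G) → Distribution G
applyMove G D u v w with w ≟ u | w ≟ v
... | yes _ | _     = D w ∸ 2
... | no _  | yes _ = D w + 1
... | no _  | no _  = D w

data Move (G : Graph) (D : Distribution G) : Distribution G → Set where
  move : (u v : Fin (n G)) → Adj G u v → 2 ≤ D u → Move G D (applyMove G D u v)

Moves : (G : Graph) → Distribution G → Distribution G → Set
Moves G = Star (Move G)

Reachable : (G : Graph) → Distribution G → Fin (n G) → Set
Reachable G D w = Σ (Distribution G) (λ D' → Moves G D D' × 1 ≤ D' w)

Solvable : (G : Graph) → Distribution G → Set
Solvable G D = ∀ w → Reachable G D w

Optimal : (G : Graph) → Distribution G → Set
Optimal G D = Solvable G D × (∀ D' → Solvable G D' → size G D ≤ size G D')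

{-# OPTIONS --safe #-}
-- Removing one of the three pebbles on v keeps D solvable. Only a vertex carrying the
-- surplus over "one pebble per vertex" can ever move, so every distribution reachable
-- from D lies below B plus two pebbles at a single vertex, where B puts one pebble on v
-- and agrees with D elsewhere. A run from D is mirrored move for move from D′ while it
-- keeps exactly one pebble more on v. When the run leaves v a second time D′ cannot
-- follow, but by then the current distribution is dominated by D′ itself, and a
-- dominated distribution can copy every move.
module Submission where

open import Defs hiding (sym)
open import Data.Nat using (ℕ; zero; suc; pred; _+_; _∸_; _≤_; z≤n; s≤s; _≤?_)
open import Data.Nat.Properties
  using ( ≤-trans; ≤-reflexive; +-suc; +-comm; +-∸-assoc; m+n∸m≡n; ∸-monoˡ-≤; +-monoˡ-≤; n≤1+n
        ; ≰⇒>; <⇒≱; module ≤-Reasoning)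
open import Data.Fin using (Fin; _≟_)
import Data.Fin as Fin
open import Data.Vec.Functional using (updateAt)
open import Data.Vec.Functional.Properties
  using (updateAt-updates; updateAt-minimal; updateAt-updateAt-local; updateAt-id)
open import Data.Vec.Functional.Relation.Binary.Pointwise using (Pointwise)
open import Data.Product using (∃-syntax; _×_; _,_)
open import Data.Sum using (_⊎_; inj₁; inj₂)
open import Function using (_∘_)
open import Relation.Nullary using (¬_; Dec; yes; no; contradiction)
open import Relation.Binary.PropositionalEquality
  using (_≡_; _≢_; _≗_; refl; sym; trans; cong; cong₂)
open import Relation.Binary.Construct.Closure.ReflexiveTransitive using (ε; _◅_; _◅◅_; fold)

infix 4 _≤ᴰ_
_≤ᴰ_ : ∀ {k} → (Fin k → ℕ) → (Fin k → ℕ) → Set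
_≤ᴰ_ = Pointwise _≤_

sumFin-cong : ∀ k {f g : Fin k → ℕ} → f ≗ g → sumFin k f ≡ sumFin k g
sumFin-cong zero    f≗g = refl
sumFin-cong (suc k) f≗g = cong₂ _+_ (f≗g Fin.zero) (sumFin-cong k (f≗g ∘ Fin.suc))

sumFin-updateAt-suc : ∀ k (f : Fin k → ℕ) i → sumFin k (updateAt f i suc) ≡ suc (sumFin k f)
sumFin-updateAt-suc (suc k) f Fin.zero    = refl
sumFin-updateAt-suc (suc k) f (Fin.suc i) =
  trans (cong (f Fin.zero +_) (sumFin-updateAt-suc k (f ∘ Fin.suc) i)) (+-suc (f Fin.zero) _)

Concentrated : ∀ {k} (B E : Fin k → ℕ) → Set
Concentrated B E = ∃[ c ] E ≤ᴰ updateAt B c (2 +_)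

surplus-source : ∀ {k} {B E : Fin k → ℕ} {c u} → (∀ w → B w ≤ 1) →
                 E ≤ᴰ updateAt B c (2 +_) → 2 ≤ E u → u ≡ c
surplus-source {B = B} {c = c} {u = u} B≤1 E≤ 2≤Eu with u ≟ c
... | yes u≡c = u≡c
... | no u≢c  = contradiction
  (≤-trans 2≤Eu (≤-trans (E≤ u) (≤-trans (≤-reflexive (updateAt-minimal u c B u≢c)) (B≤1 u))))
  λ { (s≤s ()) }

module _ {G : Graph} where

  Adj⇒≢ : ∀ {u y : Fin (n G)} → Adj G u y → u ≢ y
  Adj⇒≢ a refl = irrefl G a

  applyMove-source : ∀ (E : Distribution G) u y → applyMove G E u y u ≡ E u ∸ 2
  applyMove-source E u y with u ≟ u
  ... | yes _   = refl
  ... | no u≢u = contradiction refl u≢u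

  applyMove-target : ∀ (E : Distribution G) {u y} → u ≢ y → applyMove G E u y y ≡ E y + 1
  applyMove-target E {u} {y} u≢y with y ≟ u | y ≟ y
  ... | yes y≡u | _       = contradiction (sym y≡u) u≢y
  ... | no _    | yes _   = refl
  ... | no _    | no y≢y = contradiction refl y≢y

  applyMove-other : ∀ (E : Distribution G) {u y w} → w ≢ u → w ≢ y → applyMove G E u y w ≡ E w
  applyMove-other E {u} {y} {w} w≢u w≢y with w ≟ u | w ≟ y
  ... | yes w≡u | _       = contradiction w≡u w≢u
  ... | no _    | yes w≡y = contradiction w≡y w≢y
  ... | no _    | no _    = refl

  applyMove-local : ∀ (E E′ : Distribution G) u y w → E w ≡ E′ w →
                    applyMove G E u y w ≡ applyMove G E′ u y w
  applyMove-local E E′ u y w eq with w ≟ u | w ≟ y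
  ... | yes _ | _     = cong (_∸ 2) eq
  ... | no _  | yes _ = cong (_+ 1) eq
  ... | no _  | no _  = eq

  applyMove-mono : ∀ {E E′ : Distribution G} u y → E ≤ᴰ E′ → applyMove G E u y ≤ᴰ applyMove G E′ u y
  applyMove-mono u y E≤E′ w with w ≟ u | w ≟ y
  ... | yes _ | _     = ∸-monoˡ-≤ 2 (E≤E′ w)
  ... | no _  | yes _ = +-monoˡ-≤ 1 (E≤E′ w)
  ... | no _  | no _  = E≤E′ w

  Move-dominated : ∀ {E E′ F : Distribution G} → E ≤ᴰ E′ → Move G E F →
                   ∃[ F′ ] Move G E′ F′ × F ≤ᴰ F′
  Move-dominated E≤E′ (move u y a 2≤Eu) =
    _ , move u y a (≤-trans 2≤Eu (E≤E′ u)) , applyMove-mono u y E≤E′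

  applyMove-updateAt-suc : ∀ (E : Distribution G) c {u} y → 2 ≤ E u →
                           applyMove G (updateAt E c suc) u y ≗ updateAt (applyMove G E u y) c suc
  applyMove-updateAt-suc E c {u} y 2≤Eu w with w ≟ c
  ... | no w≢c = trans (applyMove-local _ E u y w (updateAt-minimal w c E w≢c))
                       (sym (updateAt-minimal w c (applyMove G E u y) w≢c))
  ... | yes refl rewrite updateAt-updates w {suc} (applyMove G E u y) with w ≟ u | w ≟ y
  ...   | yes refl | _     rewrite updateAt-updates w {suc} E = +-∸-assoc 1 2≤Eu
  ...   | no _     | yes _ rewrite updateAt-updates w {suc} E = refl
  ...   | no _     | no _  = updateAt-updates w E

  applyMove-surplus : ∀ {B : Distribution G} {c y} → c ≢ y →
                      applyMove G (updateAt B c (2 +_)) c y ≤ᴰ updateAt B y (2 +_)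
  applyMove-surplus {B} {c} {y} c≢y w = by-cases (w ≟ c) (w ≟ y)
    where
    open ≤-Reasoning
    by-cases : Dec (w ≡ c) → Dec (w ≡ y) →
               applyMove G (updateAt B c (2 +_)) c y w ≤ updateAt B y (2 +_) w
    by-cases (yes refl) _ = begin
      applyMove G (updateAt B w (2 +_)) w y w ≡⟨ applyMove-source _ w y ⟩
      updateAt B w (2 +_) w ∸ 2               ≡⟨ cong (_∸ 2) (updateAt-updates w B) ⟩
      2 + B w ∸ 2                             ≡⟨ m+n∸m≡n 2 (B w) ⟩
      B w                                     ≡⟨ sym (updateAt-minimal w y B c≢y) ⟩
      updateAt B y (2 +_) w                   ∎
    by-cases (no w≢c) (yes refl) = begin
      applyMove G (updateAt B c (2 +_)) c w w ≡⟨ applyMove-target _ c≢y ⟩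
      updateAt B c (2 +_) w + 1               ≡⟨ cong (_+ 1) (updateAt-minimal w c B w≢c) ⟩
      B w + 1                                 ≤⟨ ≤-trans (≤-reflexive (+-comm (B w) 1)) (n≤1+n _) ⟩
      2 + B w                                 ≡⟨ sym (updateAt-updates w B) ⟩
      updateAt B w (2 +_) w                   ∎
    by-cases (no w≢c) (no w≢y) = begin
      applyMove G (updateAt B c (2 +_)) c y w ≡⟨ applyMove-other _ w≢c w≢y ⟩
      updateAt B c (2 +_) w                   ≡⟨ updateAt-minimal w c B w≢c ⟩
      B w                                     ≡⟨ sym (updateAt-minimal w y B w≢y) ⟩
      updateAt B y (2 +_) w                   ∎

  Concentrated-step : ∀ {B E F : Distribution G} → (∀ w → B w ≤ 1) →
                      Concentrated B E → Move G E F → Concentrated B F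
  Concentrated-step B≤1 (c , E≤) (move u y a 2≤Eu) with surplus-source B≤1 E≤ 2≤Eu
  ... | refl = y , λ w → ≤-trans (applyMove-mono u y E≤ w) (applyMove-surplus (Adj⇒≢ a) w)

module OnePebbleFewer (G : Graph) (D : Distribution G) (v : Fin (n G))
                      (Dv≡3 : D v ≡ 3) (D≤1 : ∀ u → u ≢ v → D u ≤ 1) where

  D′ : Distribution G
  D′ = updateAt D v pred

  updateAt-D′-suc : updateAt D′ v suc ≗ D
  updateAt-D′-suc w =
    trans (updateAt-updateAt-local v D (trans (cong (suc ∘ pred) Dv≡3) (sym Dv≡3)) w) (updateAt-id v D w)

  D′v≡2 : D′ v ≡ 2
  D′v≡2 = trans (updateAt-updates v D) (cong pred Dv≡3)

  size-D : size G D ≡ suc (size G D′)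
  size-D = trans (sym (sumFin-cong (n G) updateAt-D′-suc)) (sumFin-updateAt-suc (n G) D′ v)

  B : Distribution G
  B = updateAt D v (λ _ → 1)

  B≡D′ : ∀ {w} → w ≢ v → B w ≡ D′ w
  B≡D′ w≢v = trans (updateAt-minimal _ v D w≢v) (sym (updateAt-minimal _ v D w≢v))

  B≤1 : ∀ w → B w ≤ 1
  B≤1 w with w ≟ v
  ... | yes refl = ≤-reflexive (updateAt-updates w D)
  ... | no w≢v  = ≤-trans (≤-reflexive (updateAt-minimal w v D w≢v)) (D≤1 w w≢v)

  D-concentrated : Concentrated B D
  D-concentrated = v , bound
    where
    bound : D ≤ᴰ updateAt B v (2 +_)
    bound w with w ≟ v
    ... | yes refl = ≤-reflexive (trans Dv≡3 (sym (trans (updateAt-updates w B)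
                                                          (cong (2 +_) (updateAt-updates w D)))))
    ... | no w≢v  = ≤-reflexive (sym (trans (updateAt-minimal w v B w≢v) (updateAt-minimal w v D w≢v)))

  below-D′ : ∀ {E} → Concentrated B E → 2 ≤ E v → E v ≤ 2 → E ≤ᴰ D′
  below-D′ {E} (c , E≤) 2≤Ev Ev≤2 with surplus-source B≤1 E≤ 2≤Ev
  ... | refl = bound
    where
    bound : E ≤ᴰ D′
    bound w with w ≟ v
    ... | yes refl = ≤-trans Ev≤2 (≤-reflexive (sym D′v≡2))
    ... | no w≢v  = ≤-trans (E≤ w) (≤-reflexive (trans (updateAt-minimal w v B w≢v) (B≡D′ w≢v)))

  Simulated : Distribution G → Set
  Simulated E = ∃[ E′ ] Moves G D′ E′ × (E ≤ᴰ E′ ⊎ E ≗ updateAt E′ v suc)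

  Simulated-dominated : ∀ {E E′ F} → Moves G D′ E′ → E ≤ᴰ E′ → Move G E F → Simulated F
  Simulated-dominated ms E≤E′ m with Move-dominated E≤E′ m
  ... | F′ , m′ , F≤F′ = F′ , ms ◅◅ (m′ ◅ ε) , inj₁ F≤F′

  Simulated-step : ∀ {E F} → Concentrated B E → Simulated E → Move G E F → Simulated F
  Simulated-step _ (E′ , ms , inj₁ E≤E′) m = Simulated-dominated ms E≤E′ m
  Simulated-step {E} conc (E′ , ms , inj₂ E≗) m@(move u y a 2≤Eu) with 2 ≤? E′ u
  ... | yes 2≤E′u =
    applyMove G E′ u y , ms ◅◅ (move u y a 2≤E′u ◅ ε) ,
    inj₂ λ w → trans (applyMove-local E _ u y w (E≗ w)) (applyMove-updateAt-suc E′ v y 2≤E′u w)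
  ... | no 2≰E′u with u ≟ v
  ...   | no u≢v   =
    contradiction (≤-trans 2≤Eu (≤-reflexive (trans (E≗ u) (updateAt-minimal u v E′ u≢v)))) 2≰E′u
  ...   | yes refl = Simulated-dominated ε (below-D′ conc 2≤Eu Ev≤2) m
    where
    Ev≤2 : E v ≤ 2
    Ev≤2 = ≤-trans (≤-reflexive (trans (E≗ v) (updateAt-updates v E′))) (≰⇒> 2≰E′u)

  Invariant : Distribution G → Set
  Invariant E = Concentrated B E × Simulated E

  Invariant-moves : ∀ {E F} → Moves G E F → Invariant E → Invariant F
  Invariant-moves = fold (λ E F → Invariant E → Invariant F)
    (λ m k → λ { (conc , sim) → k (Concentrated-step B≤1 conc m , Simulated-step conc sim m) })
    (λ inv → inv)

  reachable-D′ : ∀ {w} → w ≢ v → Reachable G D w → Reachable G D′ w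
  reachable-D′ {w} w≢v (F , ms , 1≤Fw)
    with Invariant-moves ms (D-concentrated , D′ , ε , inj₂ (sym ∘ updateAt-D′-suc))
  ... | _ , E′ , ms′ , inj₁ F≤E′ = E′ , ms′ , ≤-trans 1≤Fw (F≤E′ w)
  ... | _ , E′ , ms′ , inj₂ F≗   =
    E′ , ms′ , ≤-trans 1≤Fw (≤-reflexive (trans (F≗ w) (updateAt-minimal w v E′ w≢v)))

  solvable-D′ : Solvable G D → Solvable G D′
  solvable-D′ solvable w with w ≟ v
  ... | yes refl = D′ , ε , ≤-trans (s≤s z≤n) (≤-reflexive (sym D′v≡2))
  ... | no w≢v  = reachable-D′ w≢v (solvable w)

mainTheorem5 : (G : Graph) (D : Distribution G) (v : Fin (n G)) →
               D v ≡ 3 → (∀ u → u ≢ v → D u ≤ 1) →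
               ¬ Optimal G D
mainTheorem5 G D v Dv≡3 D≤1 (solvable , minimal) =
  <⇒≱ (≤-reflexive (sym size-D)) (minimal D′ (solvable-D′ solvable))
  where open OnePebbleFewer G D v Dv≡3 D≤1
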